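{- Let $\mathcal{B}$ be a finite left regular band and $\mathcal{G}$ a presheaf of finite groups on $\mathcal{B}$, and let $\mathcal{S}=\bigsqcup_{x\in\mathcal{B}}\mathcal{G}[x]$ with product $s\cdot t=\Delta_x^{xy}(s)\,\Delta_y^{xy}(t)$ (computed in $\mathcal{G}[xy]$) for $s\in\mathcal{G}[x]$, $t\in\mathcal{G}[y]$. Then $\mathcal{S}$ is a strict left regular band of groups. Furthermore, every strict left regular band of groups arises (up to isomorphism) in this manner.
   Context: A left regular band is a semigroup with $x^2=x$ and $xyx=xy$. On a left regular band $\mathcal{B}$, $x\preceq y$ iff $yx=y$ (a preorder). A presheaf of finite groups on $\mathcal{B}$ assigns a finite group $\mathcal{G}[x]$ to each $x\in\mathcal{B}$ and a group morphism $\Delta_x^y:\mathcal{G}[x]\to\mathcal{G}[y]$ to each pair $x\preceq y$, with $\Delta_x^x=\mathrm{id}$ and $\Delta_y^z\circ\Delta_x^y=\Delta_x^z$ whenever $x\preceq y\preceq z$ (note $x\preceq xy$ and $y\preceq xy$). For $s$ in a finite semigroup, $s^\omega$ is the unique idempotent that is a positive power of $s$. A finite semigroup $\mathcal{S}$ is a left regular band of groups if $s^\omega s=s$ and $sts^\omega=st$ for all $s,t$; it is strict if moreover $(st)^\omega=s^\omega t^\omega$ for all $s,t$. -}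

module Defs where

open import Data.Nat using (ℕ; zero; suc)
open import Data.Fin using (Fin)
open import Data.Product using (Σ; Σ-syntax; ∃; ∃-syntax; _×_; _,_; proj₁; proj₂)
open import Function.Bundles using (_↔_; Inverse)
open import Relation.Binary.PropositionalEquality using (_≡_; refl; trans; cong)
open import Algebra.Structures using (IsGroup)
open import Level using (Level) renaming (suc to lsuc)

Finite : Set → Set
Finite A = Σ ℕ λ n → A ↔ Fin n

record Magma : Set₁ where
  infixl 7 _·_
  field
    Carrier : Set
    _·_     : Carrier → Carrier → Carrier

module _ (M : Magma) where
  open Magma M

  Associative : Set
  Associative = ∀ s t u → (s · t) · u ≡ s · (t · u)

  -- positive powers: pow s k = s^(k+1)
  pow : Carrier → ℕ → Carrier
  pow s zero    = s
  pow s (suc k) = s · pow s k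

  -- e is "s^ω": an idempotent which is a positive power of s
  -- (in a finite semigroup such an e exists and is unique)
  IsOmega : Carrier → Carrier → Set
  IsOmega s e = (e · e ≡ e) × (∃[ k ] e ≡ pow s k)

  IsLRBG : Set
  IsLRBG = ∀ s t e → IsOmega s e → (e · s ≡ s) × ((s · t) · e ≡ s · t)

  IsStrict : Set
  IsStrict = ∀ s t e f g → IsOmega s e → IsOmega t f → IsOmega (s · t) g →
             g ≡ e · f

  IsFiniteStrictLRBG : Set
  IsFiniteStrictLRBG = Associative × Finite Carrier × IsLRBG × IsStrict

_≅_ : Magma → Magma → Set
M ≅ N = Σ (Magma.Carrier M ↔ Magma.Carrier N) λ φ →
  ∀ s t → Inverse.to φ (Magma._·_ M s t) ≡ Magma._·_ N (Inverse.to φ s) (Inverse.to φ t)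

record LRB : Set₁ where
  infixl 7 _·_
  field
    Carrier : Set
    _·_     : Carrier → Carrier → Carrier
    assoc   : ∀ x y z → (x · y) · z ≡ x · (y · z)
    idem    : ∀ x → x · x ≡ x
    lreg    : ∀ x y → (x · y) · x ≡ x · y

  _⪯_ : Carrier → Carrier → Set
  x ⪯ y = y · x ≡ y

  x⪯xy : ∀ x y → x ⪯ (x · y)
  x⪯xy x y = lreg x y

  y⪯xy : ∀ x y → y ⪯ (x · y)
  y⪯xy x y = trans (assoc x y y) (cong (x ·_) (idem y))

record FiniteGroup : Set₁ where
  infixl 7 _∙_
  field
    Carrier : Set
    _∙_     : Carrier → Carrier → Carrier
    ε       : Carrier
    _⁻¹     : Carrier → Carrier
    isGroup : IsGroup _≡_ _∙_ ε _⁻¹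
    finite  : Finite Carrier

IsGroupMorphism : (G H : FiniteGroup) → (FiniteGroup.Carrier G → FiniteGroup.Carrier H) → Set
IsGroupMorphism G H f = ∀ a b → f (FiniteGroup._∙_ G a b) ≡ FiniteGroup._∙_ H (f a) (f b)

record Presheaf (B : LRB) : Set₁ where
  open LRB B using (_⪯_) renaming (Carrier to Bc)
  field
    𝒢     : Bc → FiniteGroup
    Δ     : ∀ {x y} → x ⪯ y → FiniteGroup.Carrier (𝒢 x) → FiniteGroup.Carrier (𝒢 y)
    Δ-hom : ∀ {x y} (p : x ⪯ y) → IsGroupMorphism (𝒢 x) (𝒢 y) (Δ p)
    Δ-id  : ∀ {x} (p : x ⪯ x) a → Δ p a ≡ a
    Δ-comp : ∀ {x y z} (p : x ⪯ y) (q : y ⪯ z) (r : x ⪯ z) a → Δ q (Δ p a) ≡ Δ r a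

presheafMagma : (B : LRB) → Presheaf B → Magma
presheafMagma B P = record
  { Carrier = Σ (LRB.Carrier B) (λ x → FiniteGroup.Carrier (𝒢 x))
  ; _·_ = λ { (x , a) (y , b) →
        (x · y) , FiniteGroup._∙_ (𝒢 (x · y)) (Δ (x⪯xy x y) a) (Δ (y⪯xy x y) b) }
  }
  where
    open LRB B
    open Presheaf P

-- For s ∈ 𝒢[x] the powers of s stay in 𝒢[x], so the only idempotent among them is the
-- identity: s^ω = (x, ε).  Both laws of a left regular band of groups, and strictness,
-- then reduce to unit laws such as ε a = a in the fibres.
--
-- Conversely, in a finite strict left regular band of groups S the idempotents form a left
-- regular band E, every s lies in the maximal subgroup H_e of e = s^ω, and strictness makes
-- s ↦ s^ω a homomorphism onto E.  For e ⪯ f the map H_e → H_f, s ↦ f s, is a group morphism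
-- because f s f = f s, and these maps form a presheaf on E.  Its semigroup is S again, since
-- s t = (s^ω t^ω s)(s^ω t^ω t).

module Submission where

open import Defs
open import Algebra.Bundles using (Group)
import Algebra.Properties.Group as GroupProperties
open import Algebra.Structures using (IsGroup)
open import Axiom.UniquenessOfIdentityProofs using (module Decidable⇒UIP)
open import Data.Empty using (⊥-elim)
open import Data.Fin using (Fin; zero; suc; toℕ)
open import Data.Fin.Properties using (+↔⊎; pigeonhole; toℕ-mono-<; inj⇒≟)
open import Data.Nat using (ℕ; zero; suc; _+_; _*_)
open import Data.Nat.Properties using (n<1+n; +-comm; +-suc; +-identityʳ; m≤n⇒∃[o]m+o≡n)
open import Data.Nat.Tactic.RingSolver using (solve-∀)
open import Data.Product using (Σ; ∃-syntax; _×_; _,_; proj₁; proj₂)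
open import Data.Product.Function.Dependent.Propositional using (Σ-↔)
open import Data.Sum using (_⊎_; inj₁; inj₂)
open import Data.Sum.Function.Propositional using (_⊎-↔_)
open import Function.Base using (_∘_)
open import Function.Bundles using (_↔_; Inverse; Injection; mk↔ₛ′)
open import Function.Properties.Inverse using (↔-refl; ↔-sym; ↔-trans; ↔⇒↣)
open import Level using (0ℓ)
open import Relation.Binary.Definitions using (DecidableEquality)
open import Relation.Binary.PropositionalEquality
open import Relation.Nullary using (yes; no; Irrelevant)
open import Relation.Unary using (Decidable)

Σ-≡-irrelevant : {A : Set} {P : A → Set} → (∀ {x} → Irrelevant (P x)) →
                 {u v : Σ A P} → proj₁ u ≡ proj₁ v → u ≡ v
Σ-≡-irrelevant irr {x , p} {.x , q} refl = cong (x ,_) (irr p q)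

sumFin : ∀ n → (Fin n → ℕ) → ℕ
sumFin zero    m = zero
sumFin (suc n) m = m zero + sumFin n (m ∘ suc)

Σ-Fin-↔ : ∀ n {F : Fin n → Set} (m : Fin n → ℕ) →
          (∀ i → F i ↔ Fin (m i)) → Σ (Fin n) F ↔ Fin (sumFin n m)
Σ-Fin-↔ zero    m F↔ = mk↔ₛ′ (λ { (() , _) }) (λ ()) (λ ()) (λ { (() , _) })
Σ-Fin-↔ (suc n) {F} m F↔ =
  ↔-trans Σ-Fin-suc-↔ (↔-trans (F↔ zero ⊎-↔ Σ-Fin-↔ n (m ∘ suc) (F↔ ∘ suc)) (↔-sym +↔⊎))
  where
  Σ-Fin-suc-↔ : Σ (Fin (suc n)) F ↔ (F zero ⊎ Σ (Fin n) (F ∘ suc))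
  Σ-Fin-suc-↔ = mk↔ₛ′
    (λ { (zero , a) → inj₁ a ; (suc i , a) → inj₂ (i , a) })
    (λ { (inj₁ a) → zero , a ; (inj₂ (i , a)) → suc i , a })
    (λ { (inj₁ a) → refl ; (inj₂ (i , a)) → refl })
    (λ { (zero , a) → refl ; (suc i , a) → refl })

Finite-Σ : {A : Set} {F : A → Set} → Finite A → (∀ x → Finite (F x)) → Finite (Σ A F)
Finite-Σ {F = F} (n , A↔) finF =
  sumFin n (proj₁ ∘ finF ∘ from) ,
  ↔-trans (Σ-↔ A↔ λ {x} → subst (λ y → F x ↔ F y) (sym (strictlyInverseʳ x)) ↔-refl)
          (Σ-Fin-↔ n (proj₁ ∘ finF ∘ from) (proj₂ ∘ finF ∘ from))
  where open Inverse A↔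

Finite-subtype : {A : Set} {P : A → Set} → Finite A → Decidable P →
                 (∀ x → Irrelevant (P x)) → Finite (Σ A P)
Finite-subtype {P = P} finA P? P-irr = Finite-Σ finA finP
  where
  finP : ∀ x → Finite (P x)
  finP x with P? x
  ... | yes p = 1 , mk↔ₛ′ (λ _ → zero) (λ _ → p) (λ { zero → refl }) (P-irr x p)
  ... | no ¬p = 0 , mk↔ₛ′ (⊥-elim ∘ ¬p) (λ ()) (λ ()) (⊥-elim ∘ ¬p)

Finite⇒≟ : {A : Set} → Finite A → DecidableEquality A
Finite⇒≟ (_ , A↔) = inj⇒≟ (↔⇒↣ A↔)

FiniteGroup⇒Group : FiniteGroup → Group 0ℓ 0ℓ
FiniteGroup⇒Group G = record
  { Carrier = Carrier ; _≈_ = _≡_ ; _∙_ = _∙_ ; ε = ε ; _⁻¹ = _⁻¹ ; isGroup = isGroup }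
  where open FiniteGroup G

morphism-ε : (G H : FiniteGroup) (f : FiniteGroup.Carrier G → FiniteGroup.Carrier H) →
             IsGroupMorphism G H f → f (FiniteGroup.ε G) ≡ FiniteGroup.ε H
morphism-ε G H f f-hom = identityˡ-unique (f ε) (f ε)
  (trans (sym (f-hom ε ε)) (cong f (IsGroup.identityˡ (FiniteGroup.isGroup G) ε)))
  where
  open FiniteGroup G using (ε)
  open GroupProperties (FiniteGroup⇒Group H) using (identityˡ-unique)

-- The semigroup of a presheaf of groups

module PresheafSemigroup (B : LRB) (P : Presheaf B) where
  open LRB B renaming (Carrier to Bc)
  open Presheaf P
  M : Magma
  M = presheafMagma B P
  open Magma M renaming (Carrier to S; _·_ to _⋆_)

  G : Bc → Set
  G x = FiniteGroup.Carrier (𝒢 x)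

  ε⟨_⟩ : ∀ x → G x
  ε⟨ x ⟩ = FiniteGroup.ε (𝒢 x)

  mul : ∀ x → G x → G x → G x
  mul x = FiniteGroup._∙_ (𝒢 x)
  syntax mul x a b = a ∙⟨ x ⟩ b

  open module 𝒢-isGroup x = IsGroup (FiniteGroup.isGroup (𝒢 x))
    using () renaming (assoc to ∙-assoc; identityˡ to ∙-identityˡ; identityʳ to ∙-identityʳ)

  ⪯-trans : ∀ {x y z} → x ⪯ y → y ⪯ z → x ⪯ z
  ⪯-trans {x} {y} {z} zy≡y yz≡z = begin
    z · x        ≡⟨ cong (_· x) (sym yz≡z) ⟩
    (z · y) · x  ≡⟨ assoc z y x ⟩
    z · (y · x)  ≡⟨ cong (z ·_) zy≡y ⟩
    z · y        ≡⟨ yz≡z ⟩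
    z            ∎
    where open ≡-Reasoning

  ≡⇒⪯ : ∀ {x y} → x ≡ y → x ⪯ y
  ≡⇒⪯ {x} refl = idem x

  Δ-ε : ∀ {x y} (p : x ⪯ y) → Δ p ε⟨ x ⟩ ≡ ε⟨ y ⟩
  Δ-ε {x} {y} p = morphism-ε (𝒢 x) (𝒢 y) (Δ p) (Δ-hom p)

  Δ-⋆ : ∀ {x y w} (r : (x · y) ⪯ w) (p : x ⪯ w) (q : y ⪯ w) a b →
        Δ r (proj₂ ((x , a) ⋆ (y , b))) ≡ Δ p a ∙⟨ w ⟩ Δ q b
  Δ-⋆ {w = w} r p q a b = trans (Δ-hom r _ _) (cong₂ (mul w) (Δ-comp _ r p a) (Δ-comp _ r q b))

  ≡-via-Δ : ∀ {x y} {a : G x} {b : G y} → x ≡ y → (r : x ⪯ y) → Δ r a ≡ b →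
            _≡_ {A = S} (x , a) (y , b)
  ≡-via-Δ refl r Δa≡b = cong (_ ,_) (trans (sym (Δ-id r _)) Δa≡b)

  Δ-via-≡ : ∀ {x y} {a : G x} {b : G y} → _≡_ {A = S} (x , a) (y , b) → (r : x ⪯ y) → Δ r a ≡ b
  Δ-via-≡ refl r = Δ-id r _

  ⋆-assoc : Associative M
  ⋆-assoc (x , a) (y , b) (z , c) = ≡-via-Δ (assoc x y z) r (begin
    Δ r (proj₂ (((x , a) ⋆ (y , b)) ⋆ (z , c)))
      ≡⟨ Δ-⋆ r xy⪯w z⪯w _ c ⟩
    Δ xy⪯w (proj₂ ((x , a) ⋆ (y , b))) ∙⟨ w ⟩ Δ z⪯w c
      ≡⟨ cong (λ u → u ∙⟨ w ⟩ Δ z⪯w c) (Δ-⋆ xy⪯w x⪯w y⪯w a b) ⟩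
    (Δ x⪯w a ∙⟨ w ⟩ Δ y⪯w b) ∙⟨ w ⟩ Δ z⪯w c
      ≡⟨ ∙-assoc w _ _ _ ⟩
    Δ x⪯w a ∙⟨ w ⟩ (Δ y⪯w b ∙⟨ w ⟩ Δ z⪯w c)
      ≡⟨ cong (λ u → Δ x⪯w a ∙⟨ w ⟩ u) (sym (Δ-⋆ (y⪯xy x (y · z)) y⪯w z⪯w b c)) ⟩
    proj₂ ((x , a) ⋆ ((y , b) ⋆ (z , c))) ∎)
    where
    open ≡-Reasoning
    w = x · (y · z)
    r = ≡⇒⪯ (assoc x y z)
    x⪯w = x⪯xy x (y · z)
    y⪯w = ⪯-trans (x⪯xy y z) (y⪯xy x (y · z))
    z⪯w = ⪯-trans (y⪯xy y z) (y⪯xy x (y · z))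
    xy⪯w = ⪯-trans (x⪯xy (x · y) z) r

  proj₁-pow : ∀ s k → proj₁ (pow M s k) ≡ proj₁ s
  proj₁-pow s zero    = refl
  proj₁-pow s (suc k) = trans (cong (proj₁ s ·_) (proj₁-pow s k)) (idem (proj₁ s))

  idempotent⇒ε : ∀ {x} (a : G x) → (x , a) ⋆ (x , a) ≡ (x , a) → a ≡ ε⟨ x ⟩
  idempotent⇒ε {x} a aa≡a = identityˡ-unique a a (begin
    a ∙⟨ x ⟩ a                 ≡⟨ sym (cong₂ (mul x) (Δ-id x⪯x a) (Δ-id x⪯x a)) ⟩
    Δ x⪯x a ∙⟨ x ⟩ Δ x⪯x a     ≡⟨ sym (Δ-⋆ r x⪯x x⪯x a a) ⟩
    Δ r (proj₂ ((x , a) ⋆ (x , a))) ≡⟨ Δ-via-≡ aa≡a r ⟩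
    a                          ∎)
    where
    open ≡-Reasoning
    open GroupProperties (FiniteGroup⇒Group (𝒢 x)) using (identityˡ-unique)
    x⪯x = idem x
    r = ≡⇒⪯ (idem x)

  isOmega⇒ε : ∀ s e → IsOmega M s e → e ≡ (proj₁ s , ε⟨ proj₁ s ⟩)
  isOmega⇒ε s (y , c) (ee≡e , k , e≡sᵏ) with refl ← trans (cong proj₁ e≡sᵏ) (proj₁-pow s k) =
    cong (y ,_) (idempotent⇒ε c ee≡e)

  ε-⋆ : ∀ x a → (x , ε⟨ x ⟩) ⋆ (x , a) ≡ (x , a)
  ε-⋆ x a = ≡-via-Δ (idem x) r (begin
    Δ r (proj₂ ((x , ε⟨ x ⟩) ⋆ (x , a))) ≡⟨ Δ-⋆ r x⪯x x⪯x ε⟨ x ⟩ a ⟩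
    Δ x⪯x ε⟨ x ⟩ ∙⟨ x ⟩ Δ x⪯x a          ≡⟨ cong₂ (mul x) (Δ-ε x⪯x) (Δ-id x⪯x a) ⟩
    ε⟨ x ⟩ ∙⟨ x ⟩ a                      ≡⟨ ∙-identityˡ x a ⟩
    a                                   ∎)
    where
    open ≡-Reasoning
    x⪯x = idem x
    r = ≡⇒⪯ (idem x)

  ⋆-ε : ∀ {x y} → x ⪯ y → ∀ b → (y , b) ⋆ (x , ε⟨ x ⟩) ≡ (y , b)
  ⋆-ε {x} {y} x⪯y b = ≡-via-Δ x⪯y r (begin
    Δ r (proj₂ ((y , b) ⋆ (x , ε⟨ x ⟩))) ≡⟨ Δ-⋆ r (idem y) x⪯y b ε⟨ x ⟩ ⟩
    Δ (idem y) b ∙⟨ y ⟩ Δ x⪯y ε⟨ x ⟩     ≡⟨ cong₂ (mul y) (Δ-id (idem y) b) (Δ-ε x⪯y) ⟩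
    b ∙⟨ y ⟩ ε⟨ y ⟩                      ≡⟨ ∙-identityʳ y b ⟩
    b                                   ∎)
    where
    open ≡-Reasoning
    r = ≡⇒⪯ x⪯y

  ε-⋆-ε : ∀ x y → (x , ε⟨ x ⟩) ⋆ (y , ε⟨ y ⟩) ≡ (x · y , ε⟨ x · y ⟩)
  ε-⋆-ε x y = cong (x · y ,_)
    (trans (cong₂ (mul (x · y)) (Δ-ε _) (Δ-ε _)) (∙-identityˡ (x · y) _))

  ⋆-isLRBG : IsLRBG M
  ⋆-isLRBG (x , a) (y , b) e ω-e with refl ← isOmega⇒ε (x , a) e ω-e =
    ε-⋆ x a , ⋆-ε (x⪯xy x y) _

  ⋆-isStrict : IsStrict M
  ⋆-isStrict (x , a) (y , b) e f g ω-e ω-f ω-g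
    with refl ← isOmega⇒ε (x , a) e ω-e
       | refl ← isOmega⇒ε (y , b) f ω-f
       | refl ← isOmega⇒ε ((x , a) ⋆ (y , b)) g ω-g = sym (ε-⋆-ε x y)

  Finite-S : Finite Bc → Finite S
  Finite-S finB = Finite-Σ finB (FiniteGroup.finite ∘ 𝒢)

presheafMagma-isFiniteStrictLRBG : (B : LRB) → Finite (LRB.Carrier B) → (P : Presheaf B) →
                                   IsFiniteStrictLRBG (presheafMagma B P)
presheafMagma-isFiniteStrictLRBG B finB P = ⋆-assoc , Finite-S finB , ⋆-isLRBG , ⋆-isStrict
  where open PresheafSemigroup B P

-- pow S s m = s^(m+1), so exponents of the form m + n * suc m are (m+1)(n+1) - 1.
pow-exponent-comm : ∀ m n → m + n * suc m ≡ n + m * suc n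
pow-exponent-comm = solve-∀

pow-exponent-shift : ∀ c d i → d + (i + c * d) ≡ i + suc c * d
pow-exponent-shift = solve-∀

pow-exponent-double : ∀ i d' → suc ((d' * suc i + i) + (d' * suc i + i)) ≡ d' * suc i + (i + suc i * suc d')
pow-exponent-double = solve-∀

module Powers (S : Magma) (·-assoc : Associative S) where
  open Magma S

  pow-+ : ∀ s m n → pow S s m · pow S s n ≡ pow S s (suc (m + n))
  pow-+ s zero    n = refl
  pow-+ s (suc m) n = trans (·-assoc s _ _) (cong (s ·_) (pow-+ s m n))

  pow-comm : ∀ s m n → pow S s m · pow S s n ≡ pow S s n · pow S s m
  pow-comm s m n = trans (pow-+ s m n) (trans (cong (pow S s ∘ suc) (+-comm m n)) (sym (pow-+ s n m)))

  pow-pow : ∀ s m n → pow S (pow S s m) n ≡ pow S s (m + n * suc m)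
  pow-pow s m zero    = cong (pow S s) (sym (+-identityʳ m))
  pow-pow s m (suc n) = trans (cong (pow S s m ·_) (pow-pow s m n))
    (trans (pow-+ s m _) (cong (pow S s) (sym (+-suc m _))))

  pow-idempotent : ∀ e → e · e ≡ e → ∀ k → pow S e k ≡ e
  pow-idempotent e ee≡e zero    = refl
  pow-idempotent e ee≡e (suc k) = trans (cong (e ·_) (pow-idempotent e ee≡e k)) ee≡e

  omega-unique : ∀ {s e e'} → IsOmega S s e → IsOmega S s e' → e ≡ e'
  omega-unique {s} {e} {e'} (ee≡e , m , e≡sᵐ) (e'e'≡e' , n , e'≡sⁿ) = begin
    e                   ≡⟨ sym (pow-idempotent e ee≡e n) ⟩
    pow S e n           ≡⟨ cong (λ u → pow S u n) e≡sᵐ ⟩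
    pow S (pow S s m) n ≡⟨ pow-pow s m n ⟩
    pow S s (m + n * suc m) ≡⟨ cong (pow S s) (pow-exponent-comm m n) ⟩
    pow S s (n + m * suc n) ≡⟨ sym (pow-pow s n m) ⟩
    pow S (pow S s n) m ≡⟨ cong (λ u → pow S u m) (sym e'≡sⁿ) ⟩
    pow S e' m          ≡⟨ pow-idempotent e' e'e'≡e' m ⟩
    e'                  ∎
    where open ≡-Reasoning

  pow-shift : ∀ s t {m n} → pow S s m ≡ pow S s n → pow S s (t + m) ≡ pow S s (t + n)
  pow-shift s zero    sᵐ≡sⁿ = sᵐ≡sⁿ
  pow-shift s (suc t) sᵐ≡sⁿ = cong (s ·_) (pow-shift s t sᵐ≡sⁿ)

  pow-periodic : ∀ s i d → pow S s i ≡ pow S s (i + d) → ∀ c → pow S s i ≡ pow S s (i + c * d)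
  pow-periodic s i d period zero    = cong (pow S s) (sym (+-identityʳ i))
  pow-periodic s i d period (suc c) = begin
    pow S s i             ≡⟨ period ⟩
    pow S s (i + d)       ≡⟨ cong (pow S s) (+-comm i d) ⟩
    pow S s (d + i)       ≡⟨ pow-shift s d (pow-periodic s i d period c) ⟩
    pow S s (d + (i + c * d)) ≡⟨ cong (pow S s) (pow-exponent-shift c d i) ⟩
    pow S s (i + suc c * d) ∎
    where open ≡-Reasoning

  -- pow S s k = s^(k+1), and k + 1 = (i + 1)(d' + 1) is a multiple of the period ≥ i.
  periodic⇒idempotent-pow : ∀ s i d' → pow S s i ≡ pow S s (i + suc d') →
                            let k = d' * suc i + i in pow S s k · pow S s k ≡ pow S s k
  periodic⇒idempotent-pow s i d' period = begin
    pow S s k · pow S s k                    ≡⟨ pow-+ s k k ⟩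
    pow S s (suc (k + k))                    ≡⟨ cong (pow S s) (pow-exponent-double i d') ⟩
    pow S s (d' * suc i + (i + suc i * suc d'))
      ≡⟨ sym (pow-shift s (d' * suc i) (pow-periodic s i (suc d') period (suc i))) ⟩
    pow S s k                                ∎
    where
    open ≡-Reasoning
    k = d' * suc i + i

  idempotent-pow : Finite Carrier → ∀ s → ∃[ k ] pow S s k · pow S s k ≡ pow S s k
  idempotent-pow (n , C↔) s with pigeonhole (n<1+n n) (Inverse.to C↔ ∘ pow S s ∘ toℕ)
  ... | i , j , i<j , sⁱ≡sʲ with m≤n⇒∃[o]m+o≡n (toℕ-mono-< i<j)
  ... | d' , i+1+d'≡j = d' * suc (toℕ i) + toℕ i , periodic⇒idempotent-pow s (toℕ i) d'
    (trans (Injection.injective (↔⇒↣ C↔) sⁱ≡sʲ)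
           (cong (pow S s) (trans (sym i+1+d'≡j) (sym (+-suc (toℕ i) d')))))

-- The presheaf of maximal subgroups of a strict left regular band of groups

module StrictLRBG (S : Magma) (isFSLRBG : IsFiniteStrictLRBG S) where
  open Magma S renaming (Carrier to C)

  ·-assoc : Associative S
  ·-assoc = proj₁ isFSLRBG

  finite : Finite C
  finite = proj₁ (proj₂ isFSLRBG)

  isLRBG : IsLRBG S
  isLRBG = proj₁ (proj₂ (proj₂ isFSLRBG))

  isStrict : IsStrict S
  isStrict = proj₂ (proj₂ (proj₂ isFSLRBG))

  open Powers S ·-assoc

  ≡-irrelevant : ∀ {s t : C} → Irrelevant (s ≡ t)
  ≡-irrelevant = Decidable⇒UIP.≡-irrelevant (Finite⇒≟ finite)

  ω-exponent : C → ℕ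
  ω-exponent s = proj₁ (idempotent-pow finite s)

  ω : C → C
  ω s = pow S s (ω-exponent s)

  ω-idempotent : ∀ s → ω s · ω s ≡ ω s
  ω-idempotent s = proj₂ (idempotent-pow finite s)

  ω-isOmega : ∀ s → IsOmega S s (ω s)
  ω-isOmega s = ω-idempotent s , ω-exponent s , refl

  ω-unique : ∀ {s e} → IsOmega S s e → ω s ≡ e
  ω-unique = omega-unique (ω-isOmega _)

  ω-of-idempotent : ∀ {e} → e · e ≡ e → ω e ≡ e
  ω-of-idempotent ee≡e = ω-unique (ee≡e , 0 , refl)

  ω-· : ∀ s → ω s · s ≡ s
  ω-· s = proj₁ (isLRBG s s (ω s) (ω-isOmega s))

  ·-ω : ∀ s → s · ω s ≡ s
  ·-ω s = trans (pow-comm s 0 (ω-exponent s)) (ω-· s)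

  ω-homo : ∀ s t → ω (s · t) ≡ ω s · ω t
  ω-homo s t = isStrict s t _ _ _ (ω-isOmega s) (ω-isOmega t) (ω-isOmega (s · t))

  idempotent-lreg : ∀ {e} → e · e ≡ e → ∀ t → (e · t) · e ≡ e · t
  idempotent-lreg ee≡e t = proj₂ (isLRBG _ t _ (ee≡e , 0 , refl))

  idempotent-· : ∀ {e f} → e · e ≡ e → f · f ≡ f → (e · f) · (e · f) ≡ e · f
  idempotent-· {e} {f} ee≡e ff≡f = begin
    (e · f) · (e · f) ≡⟨ sym (·-assoc (e · f) e f) ⟩
    ((e · f) · e) · f ≡⟨ cong (_· f) (idempotent-lreg ee≡e f) ⟩
    (e · f) · f       ≡⟨ ·-assoc e f f ⟩
    e · (f · f)       ≡⟨ cong (e ·_) ff≡f ⟩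
    e · f             ∎
    where open ≡-Reasoning

  idempotent-·-distrib : ∀ {f} → f · f ≡ f → ∀ s t → f · (s · t) ≡ (f · s) · (f · t)
  idempotent-·-distrib {f} ff≡f s t = begin
    f · (s · t)       ≡⟨ sym (·-assoc f s t) ⟩
    (f · s) · t       ≡⟨ cong (_· t) (sym (idempotent-lreg ff≡f s)) ⟩
    ((f · s) · f) · t ≡⟨ ·-assoc (f · s) f t ⟩
    (f · s) · (f · t) ∎
    where open ≡-Reasoning

  _⁻¹ : C → C
  s ⁻¹ = pow S s (ω-exponent s + ω-exponent s)

  ·-⁻¹ : ∀ s → s · s ⁻¹ ≡ ω s
  ·-⁻¹ s = trans (pow-+ s 0 (k + k)) (trans (sym (pow-+ s k k)) (ω-idempotent s))
    where k = ω-exponent s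

  ⁻¹-· : ∀ s → s ⁻¹ · s ≡ ω s
  ⁻¹-· s = trans (pow-comm s (ω-exponent s + ω-exponent s) 0) (·-⁻¹ s)

  ω-⁻¹ : ∀ s → ω (s ⁻¹) ≡ ω s
  ω-⁻¹ s = ω-unique (ω-idempotent s , k , (begin
    ω s                          ≡⟨ sym (pow-idempotent (ω s) (ω-idempotent s) (k + k)) ⟩
    pow S (pow S s k) (k + k)     ≡⟨ pow-pow s k (k + k) ⟩
    pow S s (k + (k + k) * suc k) ≡⟨ cong (pow S s) (pow-exponent-comm k (k + k)) ⟩
    pow S s ((k + k) + k * suc (k + k)) ≡⟨ sym (pow-pow s (k + k) k) ⟩
    pow S (s ⁻¹) k                ∎))
    where
    open ≡-Reasoning
    k = ω-exponent s

  Idempotent : Set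
  Idempotent = Σ C λ e → e · e ≡ e

  idempotentBand : LRB
  idempotentBand = record
    { Carrier = Idempotent
    ; _·_     = λ (e , ee≡e) (f , ff≡f) → e · f , idempotent-· ee≡e ff≡f
    ; assoc   = λ (e , _) (f , _) (g , _) → Σ-≡-irrelevant ≡-irrelevant (·-assoc e f g)
    ; idem    = λ (e , ee≡e) → Σ-≡-irrelevant ≡-irrelevant ee≡e
    ; lreg    = λ (e , ee≡e) (f , _) → Σ-≡-irrelevant ≡-irrelevant (idempotent-lreg ee≡e f)
    }

  open LRB idempotentBand using (_⪯_)

  Finite-Idempotent : Finite Idempotent
  Finite-Idempotent = Finite-subtype finite (λ e → Finite⇒≟ finite (e · e) e) (λ _ → ≡-irrelevant)

  MaximalSubgroup : C → Set
  MaximalSubgroup e = Σ C λ s → ω s ≡ e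

  maximalSubgroup : Idempotent → FiniteGroup
  maximalSubgroup (e , ee≡e) = record
    { Carrier = MaximalSubgroup e
    ; _∙_     = _∙_
    ; ε       = e , ω-of-idempotent ee≡e
    ; _⁻¹     = λ (s , ωs≡e) → s ⁻¹ , trans (ω-⁻¹ s) ωs≡e
    ; isGroup = record
      { isMonoid = record
        { isSemigroup = record
          { isMagma = record { isEquivalence = isEquivalence ; ∙-cong = cong₂ _∙_ }
          ; assoc   = λ (s , _) (t , _) (u , _) → Σ-≡-irrelevant ≡-irrelevant (·-assoc s t u)
          }
        ; identity = (λ { (s , refl) → Σ-≡-irrelevant ≡-irrelevant (ω-· s) })
                   , (λ { (s , refl) → Σ-≡-irrelevant ≡-irrelevant (·-ω s) })
        }
      ; inverse = (λ { (s , refl) → Σ-≡-irrelevant ≡-irrelevant (⁻¹-· s) })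
                , (λ { (s , refl) → Σ-≡-irrelevant ≡-irrelevant (·-⁻¹ s) })
      ; ⁻¹-cong = λ { refl → refl }
      }
    ; finite  = Finite-subtype finite (λ s → Finite⇒≟ finite (ω s) e) (λ _ → ≡-irrelevant)
    }
    where
    _∙_ : MaximalSubgroup e → MaximalSubgroup e → MaximalSubgroup e
    (s , ωs≡e) ∙ (t , ωt≡e) = s · t , trans (ω-homo s t) (trans (cong₂ _·_ ωs≡e ωt≡e) ee≡e)

  restriction : ∀ {e f} → e ⪯ f →
                FiniteGroup.Carrier (maximalSubgroup e) → FiniteGroup.Carrier (maximalSubgroup f)
  restriction {e , _} {f , ff≡f} fe≡f (s , ωs≡e) =
    f · s , trans (ω-homo f s) (trans (cong₂ _·_ (ω-of-idempotent ff≡f) ωs≡e) (cong proj₁ fe≡f))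

  presheaf : Presheaf idempotentBand
  presheaf = record
    { 𝒢      = maximalSubgroup
    ; Δ      = restriction
    ; Δ-hom  = λ { {y = f , ff≡f} _ (s , _) (t , _) →
                   Σ-≡-irrelevant ≡-irrelevant (idempotent-·-distrib ff≡f s t) }
    ; Δ-id   = λ { _ (s , refl) → Σ-≡-irrelevant ≡-irrelevant (ω-· s) }
    ; Δ-comp = λ { {y = f , _} {z = g , _} _ gf≡g _ (s , _) →
                   Σ-≡-irrelevant ≡-irrelevant
                     (trans (sym (·-assoc g f s)) (cong (_· s) (cong proj₁ gf≡g))) }
    }

  open Magma (presheafMagma idempotentBand presheaf) using () renaming (Carrier to T)

  T-≡ : ∀ {e e' s s'} {ee≡e : e · e ≡ e} {e'e'≡e' : e' · e' ≡ e'}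
          {ωs≡e : ω s ≡ e} {ωs'≡e' : ω s' ≡ e'} → e ≡ e' → s ≡ s' →
        _≡_ {A = T} ((e , ee≡e) , (s , ωs≡e)) ((e' , e'e'≡e') , (s' , ωs'≡e'))
  T-≡ refl refl = cong₂ (λ p q → (_ , p) , (_ , q)) (≡-irrelevant _ _) (≡-irrelevant _ _)

  toT : C → T
  toT s = (ω s , ω-idempotent s) , (s , refl)

  product-decomposition : ∀ s t → s · t ≡ ((ω s · ω t) · s) · ((ω s · ω t) · t)
  product-decomposition s t = begin
    s · t                               ≡⟨ sym (ω-· (s · t)) ⟩
    ω (s · t) · (s · t)                 ≡⟨ cong (_· (s · t)) (ω-homo s t) ⟩
    (ω s · ω t) · (s · t)
      ≡⟨ idempotent-·-distrib (idempotent-· (ω-idempotent s) (ω-idempotent t)) s t ⟩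
    ((ω s · ω t) · s) · ((ω s · ω t) · t) ∎
    where open ≡-Reasoning

  ≅presheafMagma : S ≅ presheafMagma idempotentBand presheaf
  ≅presheafMagma =
    mk↔ₛ′ toT (λ (_ , (s , _)) → s) (λ { (_ , (s , refl)) → T-≡ refl refl }) (λ _ → refl) ,
    λ s t → T-≡ (ω-homo s t) (product-decomposition s t)

theoremA16 : ((B : LRB) → Finite (LRB.Carrier B) → (P : Presheaf B) →
    IsFiniteStrictLRBG (presheafMagma B P))
    ×
    ((S : Magma) → IsFiniteStrictLRBG S →
    Σ LRB λ B → Finite (LRB.Carrier B) × Σ (Presheaf B) λ P → S ≅ presheafMagma B P)
theoremA16 = presheafMagma-isFiniteStrictLRBG , λ S isFSLRBG →
  let open StrictLRBG S isFSLRBG in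
  idempotentBand , Finite-Idempotent , presheaf , ≅presheafMagma
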